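{- Let $\mathbf x$ be an infinite word over a finite alphabet and $n \ge 1$. Then $$p(n + s_n - 1, \mathbf x) = p(n + s_n - 1, \mathbf z_n) + s_n.$$
   Context: $p(m,\mathbf y)$ is the number of distinct factors of length $m$ of the infinite word $\mathbf y$, with $p(0,\mathbf y) = 1$. A factor is recurrent if it occurs infinitely often; $\mathbf y$ is $n$-recurrent if every factor of length $n$ of $\mathbf y$ is recurrent. For $n \ge 1$, $a_n$ is the shortest prefix of $\mathbf x$ such that $\mathbf x = a_n\mathbf z_n$ with $\mathbf z_n$ $n$-recurrent, and $s_n = |a_n|$. -}

module Defs where

open import Data.Nat using (ℕ; _+_; _≤_; _<_)
open import Data.Fin using (Fin; toℕ)
open import Data.Vec using (Vec; tabulate)
open import Data.List using (List; length)
open import Data.List.Relation.Unary.Unique.Propositional using (Unique)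
open import Data.List.Membership.Propositional using (_∈_)
open import Data.Product using (Σ; ∃; _×_)
open import Relation.Binary.PropositionalEquality using (_≡_)
open import Relation.Nullary using (¬_)
open import Function.Bundles using (_⇔_)

Word : ℕ → Set
Word k = ℕ → Fin k

factorAt : ∀ {k} → Word k → ℕ → (m : ℕ) → Vec (Fin k) m
factorAt x i m = tabulate (λ j → x (i + toℕ j))

IsFactor : ∀ {k m} → Word k → Vec (Fin k) m → Set
IsFactor {m = m} x w = ∃ λ i → factorAt x i m ≡ w

Recurrent : ∀ {k m} → Word k → Vec (Fin k) m → Set
Recurrent {m = m} x w = ∀ N → ∃ λ i → N ≤ i × factorAt x i m ≡ w

NRecurrent : ∀ {k} → ℕ → Word k → Set
NRecurrent {k} n x = (w : Vec (Fin k) n) → IsFactor x w → Recurrent x w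

-- the suffix x = a z with |a| = s gives z = suffix x s.
suffix : ∀ {k} → Word k → ℕ → Word k
suffix x s i = x (s + i)

-- s is s_n(x): the length of the shortest prefix a_n with x = a_n z_n, z_n n-recurrent.
IsSn : ∀ {k} → Word k → ℕ → ℕ → Set
IsSn x n s = NRecurrent n (suffix x s) × (∀ t → t < s → ¬ NRecurrent n (suffix x t))

-- p(m, y) = c : there is a duplicate-free list of exactly c words of length m
-- whose members are exactly the factors of length m of y.
HasComplexity : ∀ {k} → Word k → ℕ → ℕ → Set
HasComplexity {k} y m c =
  Σ (List (Vec (Fin k) m)) λ ws →
    length ws ≡ c × Unique ws × ((w : Vec (Fin k) m) → (w ∈ ws) ⇔ IsFactor y w)

{-# OPTIONS --safe #-}
-- Let m = n + s − 1 and s > 0. The length-n factor u at position s − 1 occurs nowhere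
-- after s − 1: otherwise it would be a factor of z_n, hence recurrent, and x with only
-- s − 1 letters removed would already be n-recurrent, contradicting the minimality of s.
-- A length-m factor starting at i < s contains u at offset s − 1 − i, so it occurs only
-- at position i. Thus these s factors are pairwise distinct and are not factors of z_n,
-- whose length-m factors are exactly those of x starting at positions ≥ s.
module Submission where

open import Defs
open import Data.Nat using (ℕ; _+_; _∸_; _≤_)
open import Relation.Binary.PropositionalEquality using (_≡_)

open import Data.Nat using (zero; suc; _<_; _<?_)
open import Data.Nat.Properties
  using (+-assoc; +-suc; +-comm; ≤-refl; ≤-pred; <-≤-trans; <-cmp; m≤m+n; m≤n⇒m≤1+n; m∸n≤m;
         m+[n∸m]≡n; ≮⇒≥; +-monoˡ-≤; +-monoˡ-<; +-monoʳ-<)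
open import Data.Fin using (Fin; toℕ; fromℕ<)
open import Data.Fin.Properties using (toℕ-fromℕ<; toℕ-injective; toℕ<n)
open import Data.Vec using (Vec; lookup)
open import Data.Vec.Properties using (tabulate-cong; lookup∘tabulate)
open import Data.List using (List; length; _++_; tabulate)
open import Data.List.Properties using (length-++; length-tabulate)
open import Data.List.Membership.Propositional using (_∈_)
open import Data.List.Membership.Propositional.Properties
  using (∈-tabulate⁺; ∈-tabulate⁻; ∈-++⁺ˡ; ∈-++⁺ʳ; ∈-++⁻)
open import Data.List.Membership.Propositional.Properties.WithK using (unique∧set⇒bag)
open import Data.List.Relation.Unary.Unique.Propositional using (Unique)
open import Data.List.Relation.Unary.Unique.Propositional.Properties using (++⁺; tabulate⁺)
open import Data.List.Relation.Binary.Disjoint.Propositional using (Disjoint)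
open import Data.List.Relation.Binary.BagAndSetEquality using (∼bag⇒↭)
open import Data.List.Relation.Binary.Permutation.Propositional.Properties using (↭-length)
open import Data.Product using (∃; _×_; _,_)
open import Data.Sum using (inj₁; inj₂)
open import Data.Empty using (⊥-elim)
open import Relation.Nullary using (yes; no)
open import Relation.Binary.PropositionalEquality using (_≢_; refl; sym; trans; cong; subst; module ≡-Reasoning)
open import Relation.Binary.Definitions using (tri<; tri≈; tri>)
open import Function.Bundles using (_⇔_; mk⇔; Equivalence)
open import Function.Construct.Composition using (_⇔-∘_)
open import Function.Construct.Symmetry using (⇔-sym)

open Equivalence

unique∧set⇒length-≡ : ∀ {a} {A : Set a} {xs ys : List A} →
  Unique xs → Unique ys → (∀ {v} → v ∈ xs ⇔ v ∈ ys) → length xs ≡ length ys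
unique∧set⇒length-≡ uxs uys xs⇔ys = ↭-length (∼bag⇒↭ (unique∧set⇒bag uxs uys xs⇔ys))

module _ {k : ℕ} (x : Word k) where

  factorAt-suffix : ∀ a i m → factorAt (suffix x a) i m ≡ factorAt x (a + i) m
  factorAt-suffix a i m = tabulate-cong (λ q → cong x (sym (+-assoc a i (toℕ q))))

  factorAt-suffix-suc : ∀ a i m → factorAt (suffix x (suc a)) i m ≡ factorAt (suffix x a) (suc i) m
  factorAt-suffix-suc a i m = tabulate-cong (λ q → cong x (sym (+-suc a (i + toℕ q))))

  factorAt-≡⇒letter-≡ : ∀ {i j m} → factorAt x i m ≡ factorAt x j m →
    ∀ {t} → t < m → x (i + t) ≡ x (j + t)
  factorAt-≡⇒letter-≡ {i} {j} {m} eq {t} t<m = begin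
    x (i + t)                  ≡⟨ cong (λ u → x (i + u)) (sym (toℕ-fromℕ< t<m)) ⟩
    x (i + toℕ f)              ≡⟨ sym (lookup∘tabulate _ f) ⟩
    lookup (factorAt x i m) f  ≡⟨ cong (λ v → lookup v f) eq ⟩
    lookup (factorAt x j m) f  ≡⟨ lookup∘tabulate _ f ⟩
    x (j + toℕ f)              ≡⟨ cong (λ u → x (j + u)) (toℕ-fromℕ< t<m) ⟩
    x (j + t)                  ∎
    where
    open ≡-Reasoning
    f = fromℕ< t<m

  factorAt-≡-inner : ∀ {i j m n} d → d + n ≤ m →
    factorAt x i m ≡ factorAt x j m → factorAt x (i + d) n ≡ factorAt x (j + d) n
  factorAt-≡-inner {i} {j} d d+n≤m eq = tabulate-cong λ q →
    trans (cong x (+-assoc i d (toℕ q)))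
      (trans (factorAt-≡⇒letter-≡ eq (<-≤-trans (+-monoʳ-< d (toℕ<n q)) d+n≤m))
        (cong x (sym (+-assoc j d (toℕ q)))))

  IsFactor-suffix⁺ : ∀ {a m} {w : Vec (Fin k) m} → IsFactor (suffix x a) w → IsFactor x w
  IsFactor-suffix⁺ {a} {m} (i , eq) = a + i , trans (sym (factorAt-suffix a i m)) eq

  IsFactor-suffix⁻ : ∀ {a j m} {w : Vec (Fin k) m} →
    a ≤ j → factorAt x j m ≡ w → IsFactor (suffix x a) w
  IsFactor-suffix⁻ {a} {j} {m} a≤j eq =
    j ∸ a , trans (factorAt-suffix a (j ∸ a) m) (trans (cong (λ p → factorAt x p m) (m+[n∸m]≡n a≤j)) eq)

  Recurrent-suffix-suc : ∀ {a m} {w : Vec (Fin k) m} →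
    Recurrent (suffix x (suc a)) w → Recurrent (suffix x a) w
  Recurrent-suffix-suc {a} {m} rec N with rec N
  ... | i , N≤i , eq = suc i , m≤n⇒m≤1+n N≤i , trans (sym (factorAt-suffix-suc a i m)) eq

  NRecurrent-suffix-pred : ∀ {n a} → NRecurrent n (suffix x (suc a)) →
    (∃ λ j → a < j × factorAt x j n ≡ factorAt x a n) → NRecurrent n (suffix x a)
  NRecurrent-suffix-pred {a = a} rec (j , a<j , eq) w (zero , eq₀) =
    Recurrent-suffix-suc {a} (rec w (IsFactor-suffix⁻ a<j (trans eq eq₀)))
  NRecurrent-suffix-pred {n} {a} rec _ w (suc i , eq) =
    Recurrent-suffix-suc {a} (rec w (i , trans (factorAt-suffix-suc a i n) eq))

  IsSn⇒early-factor-occurs-once : ∀ {n s} → IsSn x n s → ∀ {i j} → i < s → i < j →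
    factorAt x i (n + s ∸ 1) ≢ factorAt x j (n + s ∸ 1)
  IsSn⇒early-factor-occurs-once {n} {suc s} (rec , minimal) {i} {j} i<1+s i<j eq =
    minimal s ≤-refl (NRecurrent-suffix-pred rec (j + d , s<j+d , sym inner))
    where
    d = s ∸ i
    i+d≡s : i + d ≡ s
    i+d≡s = m+[n∸m]≡n (≤-pred i<1+s)
    s<j+d : s < j + d
    s<j+d = subst (_< j + d) i+d≡s (+-monoˡ-< d i<j)
    d+n≤m : d + n ≤ n + suc s ∸ 1
    d+n≤m = subst (d + n ≤_) (trans (+-comm s n) (sym (cong (_∸ 1) (+-suc n s))))
      (+-monoˡ-≤ n (m∸n≤m s i))
    inner : factorAt x s n ≡ factorAt x (j + d) n
    inner = subst (λ p → factorAt x p n ≡ factorAt x (j + d) n) i+d≡s (factorAt-≡-inner d d+n≤m eq)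

  complexity-split : ∀ {m s c d} →
    (∀ {i j} → i < s → i < j → factorAt x i m ≢ factorAt x j m) →
    HasComplexity x m c → HasComplexity (suffix x s) m d → c ≡ s + d
  complexity-split {m} {s} once (ws , refl , uws , ws-factors) (vs , refl , uvs , vs-factors) =
    begin
      length ws                           ≡⟨ unique∧set⇒length-≡ uws unique-split ws⇔split ⟩
      length (tabulate early ++ vs)       ≡⟨ length-++ (tabulate early) ⟩
      length (tabulate early) + length vs ≡⟨ cong (_+ length vs) (length-tabulate early) ⟩
      s + length vs                       ∎
    where
    open ≡-Reasoning
    early : Fin s → Vec (Fin k) m
    early f = factorAt x (toℕ f) m

    early-injective : ∀ {f g} → early f ≡ early g → f ≡ g
    early-injective {f} {g} eq with <-cmp (toℕ f) (toℕ g)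
    ... | tri< f<g _ _ = ⊥-elim (once (toℕ<n f) f<g eq)
    ... | tri≈ _ f≡g _ = toℕ-injective f≡g
    ... | tri> _ _ g<f = ⊥-elim (once (toℕ<n g) g<f (sym eq))

    disjoint : Disjoint (tabulate early) vs
    disjoint (p , q) with ∈-tabulate⁻ p | to (vs-factors _) q
    ... | f , w≡f | i , eq = once (toℕ<n f) (<-≤-trans (toℕ<n f) (m≤m+n s i))
      (trans (sym w≡f) (trans (sym eq) (factorAt-suffix s i m)))

    unique-split : Unique (tabulate early ++ vs)
    unique-split = ++⁺ (tabulate⁺ early-injective) uvs disjoint

    factor-split : ∀ {w} → w ∈ tabulate early ++ vs ⇔ IsFactor x w
    factor-split {w} = mk⇔ join split
      where
      join : w ∈ tabulate early ++ vs → IsFactor x w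
      join w∈ with ∈-++⁻ (tabulate early) w∈
      ... | inj₁ p with ∈-tabulate⁻ p
      ...   | f , w≡f = toℕ f , sym w≡f
      join w∈ | inj₂ q = IsFactor-suffix⁺ {s} (to (vs-factors w) q)
      split : IsFactor x w → w ∈ tabulate early ++ vs
      split (p , eq) with p <? s
      ... | yes p<s = ∈-++⁺ˡ (subst (_∈ tabulate early)
            (trans (cong (λ q → factorAt x q m) (toℕ-fromℕ< p<s)) eq) (∈-tabulate⁺ (fromℕ< p<s)))
      ... | no p≮s = ∈-++⁺ʳ (tabulate early) (from (vs-factors w) (IsFactor-suffix⁻ (≮⇒≥ p≮s) eq))

    ws⇔split : ∀ {w} → w ∈ ws ⇔ w ∈ tabulate early ++ vs
    ws⇔split {w} = ⇔-sym factor-split ⇔-∘ ws-factors w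

lemma2p7 : (k : ℕ) (x : Word k) (n : ℕ) → 1 ≤ n →
    (s c d : ℕ) → IsSn x n s →
    HasComplexity x (n + s ∸ 1) c →
    HasComplexity (suffix x s) (n + s ∸ 1) d →
    c ≡ d + s
lemma2p7 k x n _ s c d isSn p-x p-z =
  trans (complexity-split x (IsSn⇒early-factor-occurs-once x isSn) p-x p-z) (+-comm s d)
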